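{- Let $\Gamma$ be a strongly regular graph with parameters $(3250,57,0,1)$, let $x$ be an automorphism of $\Gamma$ of order $7$, and let $v$ be a vertex of $\Gamma$ not fixed by $x$. Then the subgraph of $\Gamma$ induced by $O_x(v)=\{v^{x^i}: i\in\{0,1,\dots,6\}\}$ is either the edgeless graph $\overline{K_7}$ or the cycle $C_7$.
   Context: A strongly regular graph $srg(n,k,\lambda,\mu)$ is a $k$-regular graph on $n$ vertices in which any two adjacent vertices have exactly $\lambda$ common neighbours and any two distinct non-adjacent vertices have exactly $\mu$ common neighbours. -}

module Defs where

open import Data.Nat using (ℕ; zero; suc; _+_; _<_; _%_)
open import Data.Bool using (Bool; true; false; _∧_)
open import Data.Fin using (Fin; toℕ)
open import Data.List using (List; []; _∷_; allFin; map)
open import Data.Product using (Σ; _×_; _,_)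
open import Data.Sum using (_⊎_)
open import Relation.Binary.PropositionalEquality using (_≡_; _≢_)
open import Function.Definitions using (Injective; Bijective)

record SimpleGraph (n : ℕ) : Set where
  field
    adj    : Fin n → Fin n → Bool
    sym    : ∀ u w → adj u w ≡ adj w u
    irrefl : ∀ u → adj u u ≡ false
open SimpleGraph public

countTrue : List Bool → ℕ
countTrue []           = 0
countTrue (true ∷ bs)  = suc (countTrue bs)
countTrue (false ∷ bs) = countTrue bs

degree : ∀ {n} → SimpleGraph n → Fin n → ℕ
degree {n} G u = countTrue (map (adj G u) (allFin n))

commonNeighbours : ∀ {n} → SimpleGraph n → Fin n → Fin n → ℕ
commonNeighbours {n} G u w = countTrue (map (λ z → adj G u z ∧ adj G w z) (allFin n))

record IsSRG (n k l m : ℕ) (G : SimpleGraph n) : Set where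
  field
    regular    : ∀ u → degree G u ≡ k
    adjCommon  : ∀ u w → u ≢ w → adj G u w ≡ true  → commonNeighbours G u w ≡ l
    nadjCommon : ∀ u w → u ≢ w → adj G u w ≡ false → commonNeighbours G u w ≡ m

iter : ∀ {A : Set} → (A → A) → ℕ → A → A
iter f zero    a = a
iter f (suc m) a = f (iter f m a)

IsAutomorphism : ∀ {n} → SimpleGraph n → (Fin n → Fin n) → Set
IsAutomorphism G x = Bijective _≡_ _≡_ x × (∀ u w → adj G (x u) (x w) ≡ adj G u w)

PowIsId : ∀ {n} → (Fin n → Fin n) → ℕ → Set
PowIsId x m = ∀ u → iter x m u ≡ u

HasOrder : ∀ {n} → (Fin n → Fin n) → ℕ → Set
HasOrder x d = PowIsId x d × (∀ m → 0 < m → m < d → Σ _ λ u → iter x m u ≢ u)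

InOrbit7 : ∀ {n} → (Fin n → Fin n) → Fin n → Fin n → Set
InOrbit7 x v u = Σ (Fin 7) λ i → iter x (toℕ i) v ≡ u

C7Adj : Fin 7 → Fin 7 → Set
C7Adj a b = (toℕ b ≡ suc (toℕ a) % 7) ⊎ (toℕ a ≡ suc (toℕ b) % 7)

InducedEdgeless : ∀ {n} → SimpleGraph n → (Fin n → Fin n) → Fin n → Set
InducedEdgeless G x v =
  ∀ u w → InOrbit7 x v u → InOrbit7 x v w → adj G u w ≡ false

InducedC7 : ∀ {n} → SimpleGraph n → (Fin n → Fin n) → Fin n → Set
InducedC7 G x v = Σ (Fin 7 → _) λ h →
  Injective _≡_ _≡_ h
  × (∀ a → InOrbit7 x v (h a))
  × (∀ u → InOrbit7 x v u → Σ (Fin 7) λ a → h a ≡ u)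
  × (∀ a b → (adj G (h a) (h b) ≡ true → C7Adj a b) × (C7Adj a b → adj G (h a) (h b) ≡ true))

-- the induced subgraph is an edgeless graph on 7 vertices: we also
-- need the orbit to have 7 elements for it to be K̄_7
InducedK7bar : ∀ {n} → SimpleGraph n → (Fin n → Fin n) → Fin n → Set
InducedK7bar G x v = Σ (Fin 7 → _) λ h →
  Injective _≡_ _≡_ h
  × (∀ a → InOrbit7 x v (h a))
  × (∀ u → InOrbit7 x v u → Σ (Fin 7) λ a → h a ≡ u)
  × InducedEdgeless G x v

-- The orbit v, x v, …, x⁶ v has seven distinct points because 7 is prime and x moves v.
-- As x is an automorphism, whether xⁱ v ~ xʲ v depends only on j − i up to sign mod 7,
-- so the induced graph is a circulant graph on ℤ/7 with connection set a union of the
-- classes ±1, ±2, ±3. Since λ = 0 the graph has no triangles, and any two classes give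
-- one (e.g. 0, 1, 2 for ±1 and ±2). So either there are no edges, or exactly one class ±d
-- is present and a ↦ d·a is an isomorphism from C₇.
module Submission where

open import Defs hiding (sym)
open import Data.Bool using (Bool; true; false; _∧_)
open import Data.Bool.Properties using () renaming (_≟_ to _≟ᵇ_)
open import Data.Empty using (⊥; ⊥-elim)
open import Data.Fin using (Fin; toℕ)
open import Data.Fin.Patterns using (0F; 1F; 2F; 3F; 4F; 5F; 6F)
open import Data.Fin.Properties using (toℕ<n; toℕ-injective; toℕ-fromℕ<; all?) renaming (_≟_ to _≟ᶠ_)
open import Data.List using (_∷_; map)
open import Data.List.Membership.Propositional using (_∈_)
open import Data.List.Membership.Propositional.Properties using (∈-allFin)
open import Data.List.Relation.Unary.Any using (here; there)
open import Data.Nat using (ℕ; zero; suc; _+_; _*_; _∸_; _%_; _/_; _<_; NonZero)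
open import Data.Nat.Coprimality using (prime⇒coprime; coprime-Bézout)
open import Data.Nat.DivMod using (_mod_; m%n<n; m≡m%n+[m/n]*n)
open import Data.Nat.GCD using (module Bézout)
open import Data.Nat.Primality using (Prime; prime?)
open import Data.Nat.Properties
  using (<-cmp; m<n⇒0<n∸m; m∸n≤m; m+[n∸m]≡n; m≤m+n; +-comm; ≤-trans; ≤-<-trans; <⇒≤)
  renaming (_≟_ to _≟ⁿ_)
open import Data.Product using (_×_; _,_; proj₁; proj₂)
open import Data.Sum using (_⊎_; inj₁; inj₂)
open import Data.Vec using ([]; _∷_; lookup)
open import Data.Vec.Properties using (lookup-replicate)
open import Function.Definitions using (Injective)
open import Relation.Binary.PropositionalEquality
  using (_≡_; _≢_; refl; sym; trans; cong; cong₂; subst; module ≡-Reasoning)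
open import Relation.Binary.Definitions using (tri<; tri≈; tri>)
open import Relation.Nullary using (Dec)
open import Relation.Nullary.Decidable using (True; toWitness; from-yes; _×-dec_; _→-dec_; _⊎-dec_)

iter-+ : ∀ {A : Set} (f : A → A) m n a → iter f (m + n) a ≡ iter f m (iter f n a)
iter-+ f zero    n a = refl
iter-+ f (suc m) n a = cong f (iter-+ f m n a)

iter-*-fixed : ∀ {A : Set} (f : A → A) {p a} → iter f p a ≡ a → ∀ k → iter f (k * p) a ≡ a
iter-*-fixed f         e zero    = refl
iter-*-fixed f {p} {a} e (suc k) = begin
  iter f (p + k * p) a         ≡⟨ iter-+ f p (k * p) a ⟩
  iter f p (iter f (k * p) a)  ≡⟨ cong (iter f p) (iter-*-fixed f e k) ⟩
  iter f p a                   ≡⟨ e ⟩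
  a                            ∎
  where open ≡-Reasoning

iter-% : ∀ {A : Set} (f : A → A) {p a} .{{_ : NonZero p}} → iter f p a ≡ a →
         ∀ m → iter f (m % p) a ≡ iter f m a
iter-% f {p} {a} e m = begin
  iter f (m % p) a                        ≡⟨ cong (iter f (m % p)) (iter-*-fixed f e (m / p)) ⟨
  iter f (m % p) (iter f (m / p * p) a)   ≡⟨ iter-+ f (m % p) (m / p * p) a ⟨
  iter f (m % p + m / p * p) a            ≡⟨ cong (λ k → iter f k a) (m≡m%n+[m/n]*n m p) ⟨
  iter f m a                              ∎
  where open ≡-Reasoning

iter-injective : ∀ {A : Set} {f : A → A} → Injective _≡_ _≡_ f →
                 ∀ m {a b} → iter f m a ≡ iter f m b → a ≡ b
iter-injective f-inj zero    e = e
iter-injective f-inj (suc m) e = iter-injective f-inj m (f-inj e)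

-- Bézout gives 1 + z k = y p or 1 + y p = z k; either way f a is reached from a
-- by iterating a multiple of k and a multiple of p.
fixed-by-prime-period : ∀ {A : Set} (f : A → A) {p k a} → Prime p →
                        iter f p a ≡ a → 0 < k → k < p → iter f k a ≡ a → f a ≡ a
fixed-by-prime-period f {p} {suc k} {a} p-prime fixed-p _ k<p fixed-k
  with coprime-Bézout (prime⇒coprime p-prime k<p)
... | Bézout.+- y z 1+zk≡yp = begin
  f a                         ≡⟨ cong f (iter-*-fixed f fixed-k z) ⟨
  iter f (1 + z * suc k) a    ≡⟨ cong (λ m → iter f m a) 1+zk≡yp ⟩
  iter f (y * p) a            ≡⟨ iter-*-fixed f fixed-p y ⟩
  a                           ∎
  where open ≡-Reasoning
... | Bézout.-+ y z 1+yp≡zk = begin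
  f a                         ≡⟨ cong f (iter-*-fixed f fixed-p y) ⟨
  iter f (1 + y * p) a        ≡⟨ cong (λ m → iter f m a) 1+yp≡zk ⟩
  iter f (z * suc k) a        ≡⟨ iter-*-fixed f fixed-k z ⟩
  a                           ∎
  where open ≡-Reasoning

iter-≢-below-prime-period :
  ∀ {A : Set} {f : A → A} {p a} → Prime p → Injective _≡_ _≡_ f → iter f p a ≡ a → f a ≢ a →
  ∀ {m n} → m < n → n < p → iter f m a ≢ iter f n a
iter-≢-below-prime-period {f = f} {p} {a} p-prime f-inj fixed-p moved {m} {n} m<n n<p e =
  moved (fixed-by-prime-period f p-prime fixed-p (m<n⇒0<n∸m m<n) (≤-<-trans (m∸n≤m n m) n<p)
                               (sym (iter-injective f-inj m (trans e iter-n))))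
  where
  iter-n : iter f n a ≡ iter f m (iter f (n ∸ m) a)
  iter-n = trans (cong (λ k → iter f k a) (sym (m+[n∸m]≡n (<⇒≤ m<n)))) (iter-+ f m (n ∸ m) a)

iter-injective-below-prime-period :
  ∀ {A : Set} {f : A → A} {p a} → Prime p → Injective _≡_ _≡_ f → iter f p a ≡ a → f a ≢ a →
  ∀ {m n} → m < p → n < p → iter f m a ≡ iter f n a → m ≡ n
iter-injective-below-prime-period p-prime f-inj fixed-p moved {m} {n} m<p n<p e with <-cmp m n
... | tri< m<n _ _ = ⊥-elim (iter-≢-below-prime-period p-prime f-inj fixed-p moved m<n n<p e)
... | tri≈ _ m≡n _ = m≡n
... | tri> _ _ n<m = ⊥-elim (iter-≢-below-prime-period p-prime f-inj fixed-p moved n<m m<p (sym e))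

adj-iter : ∀ {n} (G : SimpleGraph n) {x : Fin n → Fin n} → IsAutomorphism G x →
           ∀ m u w → adj G (iter x m u) (iter x m w) ≡ adj G u w
adj-iter G aut zero    u w = refl
adj-iter G aut (suc m) u w = trans (proj₂ aut _ _) (adj-iter G aut m u w)

adj⇒≢ : ∀ {n} (G : SimpleGraph n) {u w} → adj G u w ≡ true → u ≢ w
adj⇒≢ G {u} uw refl with () ← trans (sym (irrefl G u)) uw

countTrue-map≡0 : ∀ {A : Set} (f : A → Bool) {xs} → countTrue (map f xs) ≡ 0 →
                  ∀ {z} → z ∈ xs → f z ≡ false
countTrue-map≡0 f {y ∷ xs} c z∈ with f y in fy
countTrue-map≡0 f {y ∷ xs} c (here refl) | false = fy
countTrue-map≡0 f {y ∷ xs} c (there z∈)  | false = countTrue-map≡0 f c z∈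

λ≡0⇒triangle-free : ∀ {n k μ} {G : SimpleGraph n} → IsSRG n k 0 μ G →
                    ∀ {u w z} → adj G u w ≡ true → adj G u z ≡ true → adj G w z ≡ true → ⊥
λ≡0⇒triangle-free {n} {G = G} srg {u} {w} {z} uw uz wz =
  true≢false (trans (sym (cong₂ _∧_ uz wz)) z-not-common)
  where
  true≢false : true ≢ false
  true≢false ()
  z-not-common : (adj G u z ∧ adj G w z) ≡ false
  z-not-common = countTrue-map≡0 (λ t → adj G u t ∧ adj G w t)
                   (IsSRG.adjCommon srg u w (adj⇒≢ G uw) uw) (∈-allFin z)

_⊖_ : Fin 7 → Fin 7 → Fin 7
j ⊖ i = (7 + toℕ j ∸ toℕ i) mod 7

scale : ℕ → Fin 7 → Fin 7
scale d a = (d * toℕ a) mod 7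

-- Connection pattern of a circulant graph on ℤ/7: b_d says whether differences ±d are edges.
circulant : Bool → Bool → Bool → Fin 7 → Bool
circulant b₁ b₂ b₃ = lookup (false ∷ b₁ ∷ b₂ ∷ b₃ ∷ b₃ ∷ b₂ ∷ b₁ ∷ [])

C7Adj? : ∀ a b → Dec (C7Adj a b)
C7Adj? a b = (toℕ b ≟ⁿ suc (toℕ a) % 7) ⊎-dec (toℕ a ≟ⁿ suc (toℕ b) % 7)

Inverses : (σ τ : Fin 7 → Fin 7) → Set
Inverses σ τ = (∀ i → σ (τ i) ≡ i) × (∀ a → τ (σ a) ≡ a)

inverses? : ∀ σ τ → Dec (Inverses σ τ)
inverses? σ τ = all? (λ i → σ (τ i) ≟ᶠ i) ×-dec all? (λ a → τ (σ a) ≟ᶠ a)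

CycleLabelling : (Fin 7 → Bool) → (Fin 7 → Fin 7) → Set
CycleLabelling c σ =
  ∀ a b → (c (σ b ⊖ σ a) ≡ true → C7Adj a b) × (C7Adj a b → c (σ b ⊖ σ a) ≡ true)

cycleLabelling? : ∀ c σ → Dec (CycleLabelling c σ)
cycleLabelling? c σ = all? λ a → all? λ b →
  (c (σ b ⊖ σ a) ≟ᵇ true →-dec C7Adj? a b) ×-dec (C7Adj? a b →-dec c (σ b ⊖ σ a) ≟ᵇ true)

module Orbit7 {n} (G : SimpleGraph n) {x : Fin n → Fin n} (aut : IsAutomorphism G x)
              {v : Fin n} (x⁷v≡v : iter x 7 v ≡ v) (moved : x v ≢ v) where

  orbit : Fin 7 → Fin n
  orbit i = iter x (toℕ i) v

  orbit-injective : Injective _≡_ _≡_ orbit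
  orbit-injective {i} {j} e = toℕ-injective
    (iter-injective-below-prime-period (from-yes (prime? 7)) (proj₁ (proj₁ aut)) x⁷v≡v moved
                                       (toℕ<n i) (toℕ<n j) e)

  orbit-shift : ∀ i j → orbit j ≡ iter x (toℕ i) (orbit (j ⊖ i))
  orbit-shift i j = begin
    iter x (toℕ j) v                   ≡⟨ cong (iter x (toℕ j)) x⁷v≡v ⟨
    iter x (toℕ j) (iter x 7 v)        ≡⟨ iter-+ x (toℕ j) 7 v ⟨
    iter x (toℕ j + 7) v               ≡⟨ cong (λ m → iter x m v) i+r≡j+7 ⟨
    iter x (toℕ i + r) v               ≡⟨ iter-+ x (toℕ i) r v ⟩
    iter x (toℕ i) (iter x r v)        ≡⟨ cong (iter x (toℕ i)) (iter-% x x⁷v≡v r) ⟨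
    iter x (toℕ i) (iter x (r % 7) v)  ≡⟨ cong (λ m → iter x (toℕ i) (iter x m v)) r%7≡toℕ[j⊖i] ⟩
    iter x (toℕ i) (orbit (j ⊖ i))     ∎
    where
    open ≡-Reasoning
    r : ℕ
    r = 7 + toℕ j ∸ toℕ i
    i+r≡j+7 : toℕ i + r ≡ toℕ j + 7
    i+r≡j+7 = trans (m+[n∸m]≡n (≤-trans (<⇒≤ (toℕ<n i)) (m≤m+n 7 (toℕ j)))) (+-comm 7 (toℕ j))
    r%7≡toℕ[j⊖i] : r % 7 ≡ toℕ (j ⊖ i)
    r%7≡toℕ[j⊖i] = sym (toℕ-fromℕ< (m%n<n r 7))

  adj-orbit : ∀ i j → adj G (orbit i) (orbit j) ≡ adj G v (orbit (j ⊖ i))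
  adj-orbit i j = trans (cong (adj G (orbit i)) (orbit-shift i j))
                        (adj-iter G aut (toℕ i) v (orbit (j ⊖ i)))

  adj-orbit-neg : ∀ d → adj G v (orbit d) ≡ adj G v (orbit (0F ⊖ d))
  adj-orbit-neg d = trans (SimpleGraph.sym G v (orbit d)) (adj-orbit d 0F)

  adj-orbit-circulant : ∀ {b₁ b₂ b₃} → adj G v (orbit 1F) ≡ b₁ → adj G v (orbit 2F) ≡ b₂ →
    adj G v (orbit 3F) ≡ b₃ → ∀ i j → adj G (orbit i) (orbit j) ≡ circulant b₁ b₂ b₃ (j ⊖ i)
  adj-orbit-circulant {b₁} {b₂} {b₃} e₁ e₂ e₃ i j = trans (adj-orbit i j) (adj-from-v (j ⊖ i))
    where
    adj-from-v : ∀ d → adj G v (orbit d) ≡ circulant b₁ b₂ b₃ d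
    adj-from-v 0F = irrefl G v
    adj-from-v 1F = e₁
    adj-from-v 2F = e₂
    adj-from-v 3F = e₃
    adj-from-v 4F = trans (adj-orbit-neg 4F) e₃
    adj-from-v 5F = trans (adj-orbit-neg 5F) e₂
    adj-from-v 6F = trans (adj-orbit-neg 6F) e₁

  induced-K7bar : (∀ i j → adj G (orbit i) (orbit j) ≡ false) → InducedK7bar G x v
  induced-K7bar edgeless =
    orbit , orbit-injective , (λ a → a , refl) , (λ { u (i , refl) → i , refl })
    , λ { u w (i , refl) (j , refl) → edgeless i j }

  induced-C7 : ∀ {c σ τ} → (∀ i j → adj G (orbit i) (orbit j) ≡ c (j ⊖ i)) →
               Inverses σ τ → CycleLabelling c σ → InducedC7 G x v
  induced-C7 {c} {σ} {τ} adj≡c (στ≗id , τσ≗id) cycle =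
    (λ a → orbit (σ a)) , injective , (λ a → σ a , refl)
    , (λ { u (i , refl) → τ i , cong orbit (στ≗id i) })
    , λ a b → subst (λ β → (β ≡ true → C7Adj a b) × (C7Adj a b → β ≡ true))
                    (sym (adj≡c (σ a) (σ b))) (cycle a b)
    where
    injective : Injective _≡_ _≡_ (λ a → orbit (σ a))
    injective {a} {b} e = trans (sym (τσ≗id a)) (trans (cong τ (orbit-injective e)) (τσ≗id b))

  -- For concrete b's and d the side condition evaluates to ⊤, so callers never supply it.
  induced-C7-by-scaling :
    ∀ {b₁ b₂ b₃} → (∀ i j → adj G (orbit i) (orbit j) ≡ circulant b₁ b₂ b₃ (j ⊖ i)) → ∀ d d⁻¹ →
    {_ : True (inverses? (scale d) (scale d⁻¹) ×-dec cycleLabelling? (circulant b₁ b₂ b₃) (scale d))} →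
    InducedC7 G x v
  induced-C7-by-scaling {b₁} {b₂} {b₃} adj≡c d d⁻¹ {ok} =
    induced-C7 {circulant b₁ b₂ b₃} {scale d} {scale d⁻¹} adj≡c (proj₁ (toWitness ok)) (proj₂ (toWitness ok))

mainTheorem16 : (Γ : SimpleGraph 3250) → IsSRG 3250 57 0 1 Γ
    → (x : Fin 3250 → Fin 3250) → IsAutomorphism Γ x → HasOrder x 7
    → (v : Fin 3250) → x v ≢ v
    → InducedK7bar Γ x v ⊎ InducedC7 Γ x v
mainTheorem16 Γ srg x aut ord v moved = classify (adj-orbit-circulant refl refl refl)
  where
  open Orbit7 Γ aut (proj₁ ord v) moved
  classify : ∀ {b₁ b₂ b₃} → (∀ i j → adj Γ (orbit i) (orbit j) ≡ circulant b₁ b₂ b₃ (j ⊖ i)) →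
             InducedK7bar Γ x v ⊎ InducedC7 Γ x v
  classify {true}  {true}  {_}     c = ⊥-elim (λ≡0⇒triangle-free srg (c 0F 1F) (c 0F 2F) (c 1F 2F))
  classify {true}  {false} {true}  c = ⊥-elim (λ≡0⇒triangle-free srg (c 0F 3F) (c 0F 4F) (c 3F 4F))
  classify {false} {true}  {true}  c = ⊥-elim (λ≡0⇒triangle-free srg (c 0F 2F) (c 0F 4F) (c 2F 4F))
  classify {false} {false} {false} c =
    inj₁ (induced-K7bar λ i j → trans (c i j) (lookup-replicate (j ⊖ i) false))
  classify {true}  {false} {false} c = inj₂ (induced-C7-by-scaling c 1 1)
  classify {false} {true}  {false} c = inj₂ (induced-C7-by-scaling c 2 4)
  classify {false} {false} {true}  c = inj₂ (induced-C7-by-scaling c 3 5)
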